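{- Let $\lambda=\lambda_1\Lambda_1+\lambda_2\Lambda_2$ be a dominant weight and $T=C_1\cdots C_s\ne T_\lambda$ a tableau of type $G_2$ of shape $\lambda$. Then the tabloid $T_1$ constructed from $T$ (as described in the context) is a tableau of type $G_2$ of shape $\lambda$.
   Context: $\mathcal{G}=\{1,2,3,0,\bar3,\bar2,\bar1\}$ with $1\prec2\prec3\prec0\prec\bar3\prec\bar2\prec\bar1$; crystal $B(\Lambda_1)$: $1\xrightarrow{1}2\xrightarrow{2}3\xrightarrow{1}0\xrightarrow{1}\bar3\xrightarrow{2}\bar2\xrightarrow{1}\bar1$ ($a\xrightarrow{i}b$ means $\tilde f_ia=b,\tilde e_ib=a$; other applications give $0$); $\varepsilon_i(u)=\max\{k:\tilde e_i^ku\ne0\}$, $\varphi_i(u)=\max\{k:\tilde f_i^ku\ne0\}$. Words are vertices of tensor powers of $B(\Lambda_1)$ with $\tilde f_i(u\otimes v)=\tilde f_iu\otimes v$ if $\varphi_i(u)>\varepsilon_i(v)$, else $u\otimes\tilde f_iv$; $\tilde e_i(u\otimes v)=u\otimes\tilde e_iv$ if $\varphi_i(u)<\varepsilon_i(v)$, else $\tilde e_iu\otimes v$. Columns and tableaux: $\mathrm{dist}(a,b)$ is the number of arrows between $a$ and $b$ in the chain. A column is $[a]$ or (top $a$, bottom $b$) with $a\prec b$ or $a=b=0$; its reading $\mathrm{w}(C)$ is read top to bottom. Height-1 columns are admissible; $(a,b)$ is admissible if $\mathrm{dist}(a,b)\le2$ for $a\in\{1,0\}$, $\le3$ otherwise.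 $C_1\preceq C_2$ means (i) $[a],[b]$ with $a\preceq b$, $(a,b)\ne(0,0)$; (ii) $(a,b),[c]$ with $a\preceq c$, $(a,c)\ne(0,0)$; (iii) $(a,b),(c,d)$ with $a\preceq c$, $(a,c)\ne(0,0)$, $b\preceq d$, $(b,d)\neq(0,0)$ and $\mathrm{dist}(a,d)\ge3$ if $a\in\{2,3,0\}$, $\ge2$ if $a=\bar3$. A tableau of type $G_2$ of shape $\lambda$ is a filling $C_1\cdots C_s$ of the diagram with $\lambda_2$ columns of height 2 followed by $\lambda_1$ of height 1, by admissible columns with $C_i\preceq C_{i+1}$; a tabloid is such a filling by arbitrary columns. $T_\lambda$ is the tableau whose $k$-th row is filled with $k$. Modules: $U_q(G_2)$ with generators $e_i,f_i,t_i^{\pm1}$ (Cartan matrix $\begin{pmatrix}2&-1\\-3&2\end{pmatrix}$, $q_1=q$, $q_2=q^3$), tensor rule $f_i(u\otimes v)=f_iu\otimes v+t_iu\otimes f_iv$, $t_i(u\otimes v)=t_iu\otimes t_iv$. $V(\Lambda_1)$ has basis $v_x$ ($x\in\mathcal{G}$), $t_iv_x=q_i^{m_i(x)}v_x$ with $(m_1,m_2)=(1,0),(-1,1),(2,-1),(0,0),(-2,1),(1,-1),(-1,0)$ for $x=1,2,3,0,\bar3,\bar2,\bar1$; for $x\ne0$, $f_iv_x=v_y$ if $x\xrightarrow{i}y$, else $0$; $f_iv_0=\delta_{i,1}(q+q^{ -1})v_{\bar3}$ (and $e_i$ dually, $e_iv_0=\delta_{i,1}(q+q^{ -1})v_3$).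 $W(\Lambda_2)=V(\Lambda_1)^{\otimes2}/N$ with $N\cong V(2\Lambda_1)$ the corresponding summand; $v_a\wedge v_b$ is the image of $v_a\otimes v_b$. For a height-1 column $[a]$, $v_{[a]}=v_a\in V(\Lambda_1)$; for a height-2 column $(a,b)$, $v_C=v_a\wedge v_b\in W(\Lambda_2)$. Construction of $T_1$ from $T=C_1\cdots C_s\neq T_\lambda$: let $C_k$ be the rightmost column with $\mathrm{w}(C_k)\notin\{1,12\}$. If $\mathrm{w}(C_k)\ne0\bar2$, let $i_1\in\{1,2\}$ be the unique index with $\tilde e_{i_1}(\mathrm{w}(C_k))\ne0$; if $\mathrm{w}(C_k)=0\bar2$, let $i_1=1$. If $k=1$ set $l=1$. If $k>1$ and ($f_{i_1}v_{C_k}\ne0$ or $\tilde e_{i_1}(\mathrm{w}(C_{k-1}))=0$), set $l=k$. Otherwise let $l$ be the lowest integer $l<k$ such that (i) $f_{i_1}v_{C_j}=0$ for $j=l+1,\dots,k$ and (ii) $\tilde e_{i_1}(\mathrm{w}(C_j))\ne0$ for $j=l,\dots,k$. Put $\varepsilon_{i_1,j}=\varepsilon_{i_1}(\mathrm{w}(C_j))$ for $j=l,\dots,k$, $r_1=\sum_{j=l}^k\varepsilon_{i_1,j}$, and let $T_1$ be the tabloid obtained from $T$ by replacing each $C_j$, $l\le j\le k$, by the column whose reading is $\tilde e_{i_1}^{\varepsilon_{i_1,j}}(\mathrm{w}(C_j))$. -}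

module Defs where

open import Data.Nat using (ℕ; zero; suc; _+_; _*_; _<_; _≤_; _≥_; _<ᵇ_)
open import Data.Integer as ℤ using (ℤ; +_; -[1+_])
open import Data.List using (List; []; _∷_; _++_; replicate; foldr; map)
open import Data.Vec as Vec using (Vec; lookup; tabulate)
open import Data.Fin using (Fin; toℕ)
open import Data.Maybe using (Maybe; just; nothing)
open import Data.Product using (Σ; _×_; _,_; ∃)
open import Data.Empty using (⊥)
open import Data.Unit using (⊤)
open import Data.Sum using (_⊎_)
open import Data.Bool using (Bool; true; false; if_then_else_)
open import Relation.Binary.PropositionalEquality using (_≡_; _≢_)
open import Relation.Nullary using (¬_)

data G : Set where
  g1 g2 g3 g0 g3b g2b g1b : G

data I : Set where
  i₁ i₂ : I

allG : List G
allG = g1 ∷ g2 ∷ g3 ∷ g0 ∷ g3b ∷ g2b ∷ g1b ∷ []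

rank : G → ℕ
rank g1 = 0
rank g2 = 1
rank g3 = 2
rank g0 = 3
rank g3b = 4
rank g2b = 5
rank g1b = 6

_≺_ : G → G → Set
a ≺ b = rank a < rank b

_≼_ : G → G → Set
a ≼ b = rank a ≤ rank b

-- number of arrows between a and b in the chain 1→2→3→0→3̄→2̄→1̄
dist : G → G → ℕ
dist a b = ∣ rank a - rank b ∣
  where
  ∣_-_∣ : ℕ → ℕ → ℕ
  ∣ zero - n ∣ = n
  ∣ suc m - zero ∣ = suc m
  ∣ suc m - suc n ∣ = ∣ m - n ∣

-- The crystal B(Λ₁):  1 -1-> 2 -2-> 3 -1-> 0 -1-> 3̄ -2-> 2̄ -1-> 1̄

fL : I → G → Maybe G
fL i₁ g1 = just g2
fL i₂ g2 = just g3
fL i₁ g3 = just g0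
fL i₁ g0 = just g3b
fL i₂ g3b = just g2b
fL i₁ g2b = just g1b
fL _ _ = nothing

eL : I → G → Maybe G
eL i₁ g2 = just g1
eL i₂ g3 = just g2
eL i₁ g0 = just g3
eL i₁ g3b = just g0
eL i₂ g2b = just g3b
eL i₁ g1b = just g2b
eL _ _ = nothing

-- count k such that op^k a ≠ 0 (iterating at most `fuel` times).
-- With enough fuel this is max{k : op^k a ≠ 0}.
countIter : {A : Set} → ℕ → (A → Maybe A) → A → ℕ
countIter zero op a = 0
countIter (suc n) op a with op a
... | nothing = 0
... | just b = suc (countIter n op b)

-- all ε_i, φ_i of letters are ≤ 2 and of words of length ≤ 2 are ≤ 4,
-- so fuel 8 is sufficient (the counts are exact).
fuel : ℕ
fuel = 8

εL φL : I → G → ℕ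
εL i a = countIter fuel (eL i) a
φL i a = countIter fuel (fL i) a

-- Columns (as raw fillings); a column is identified with its reading
-- w(C) (top to bottom): col1 a has reading a, col2 a b reading a ⊗ b.

data Col : Set where
  col1 : G → Col
  col2 : G → G → Col

-- ẽ_i on readings (words of length 1 or 2) by the tensor product rule
-- ẽ_i(u ⊗ v) = u ⊗ ẽ_i v if φ_i(u) < ε_i(v), else ẽ_i u ⊗ v.
eW : I → Col → Maybe Col
eW i (col1 a) with eL i a
... | just a' = just (col1 a')
... | nothing = nothing
eW i (col2 a b) with φL i a <ᵇ εL i b
... | true with eL i b
...   | just b' = just (col2 a b')
...   | nothing = nothing
eW i (col2 a b) | false with eL i a
...   | just a' = just (col2 a' b)
...   | nothing = nothing

εW : I → Col → ℕ
εW i C = countIter fuel (eW i) C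

eIter : ℕ → I → Col → Maybe Col
eIter zero i C = just C
eIter (suc n) i C with eIter n i C
... | just C' = eW i C'
... | nothing = nothing

-- the column whose reading is ẽ_i^{ε_i(w(C))}(w(C))
-- (this is always nonzero; the fallback C is never used)
raise : I → Col → Col
raise i C with eIter (εW i C) i C
... | just C' = C'
... | nothing = C

IsColumn : Col → Set
IsColumn (col1 a) = ⊤
IsColumn (col2 a b) = (a ≺ b) ⊎ (a ≡ g0 × b ≡ g0)

admBound : G → ℕ
admBound g1 = 2
admBound g0 = 2
admBound _ = 3

Admissible : Col → Set
Admissible (col1 a) = ⊤
Admissible (col2 a b) = dist a b ≤ admBound a

distReq : G → ℕ
distReq g2 = 3
distReq g3 = 3
distReq g0 = 3
distReq g3b = 2
distReq _ = 0

NotBoth0 : G → G → Set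
NotBoth0 a b = ¬ (a ≡ g0 × b ≡ g0)

_⊑_ : Col → Col → Set
col1 a ⊑ col1 b = a ≼ b × NotBoth0 a b
col2 a b ⊑ col1 c = a ≼ c × NotBoth0 a c
col2 a b ⊑ col2 c d =
  a ≼ c × NotBoth0 a c × b ≼ d × NotBoth0 b d × distReq a ≤ dist a d
col1 a ⊑ col2 c d = ⊥

height : Col → ℕ
height (col1 _) = 1
height (col2 _ _) = 2

IsTableau : (λ₁ λ₂ : ℕ) → Vec Col (λ₂ + λ₁) → Set
IsTableau λ₁ λ₂ T =
  (∀ (j : Fin (λ₂ + λ₁)) → height (lookup T j) ≡ (if toℕ j <ᵇ λ₂ then 2 else 1))
  × (∀ j → IsColumn (lookup T j))
  × (∀ j → Admissible (lookup T j))
  × (∀ (j j' : Fin (λ₂ + λ₁)) → suc (toℕ j) ≡ toℕ j' → lookup T j ⊑ lookup T j')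

Tλ : (λ₁ λ₂ : ℕ) → Vec Col (λ₂ + λ₁)
Tλ λ₁ λ₂ = Vec.replicate λ₂ (col2 g1 g2) Vec.++ Vec.replicate λ₁ (col1 g1)

-- The module side.  Coefficients: Laurent polynomials ℤ[q,q⁻¹]
-- (a pair (s , p) stands for q^{-s} · Σᵢ pᵢ qⁱ).

Poly : Set
Poly = List ℤ

addP : Poly → Poly → Poly
addP [] q = q
addP (a ∷ p) [] = a ∷ p
addP (a ∷ p) (b ∷ q) = (a ℤ.+ b) ∷ addP p q

mulP : Poly → Poly → Poly
mulP [] q = []
mulP (a ∷ p) q = addP (map (a ℤ.*_) q) ((+ 0) ∷ mulP p q)

record Lau : Set where
  constructor lau
  field
    sh : ℕ
    cs : Poly
open Lau public

_+L_ : Lau → Lau → Lau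
x +L y = lau (sh x + sh y)
  (addP (replicate (sh y) (+ 0) ++ cs x) (replicate (sh x) (+ 0) ++ cs y))

_*L_ : Lau → Lau → Lau
x *L y = lau (sh x + sh y) (mulP (cs x) (cs y))

coefP : Poly → ℕ → ℤ
coefP [] _ = + 0
coefP (a ∷ p) zero = a
coefP (a ∷ p) (suc n) = coefP p n

coeff : Lau → ℤ → ℤ
coeff x n with n ℤ.+ (+ sh x)
... | + m = coefP (cs x) m
... | -[1+ _ ] = + 0

_≈L_ : Lau → Lau → Set
x ≈L y = ∀ n → coeff x n ≡ coeff y n

0L 1L : Lau
0L = lau 0 []
1L = lau 0 (+ 1 ∷ [])

qPow : ℤ → Lau
qPow (+ m) = lau 0 (replicate m (+ 0) ++ (+ 1 ∷ []))
qPow -[1+ m ] = lau (suc m) (+ 1 ∷ [])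

sumL : List Lau → Lau
sumL = foldr _+L_ 0L

sumG : (G → Lau) → Lau
sumG h = sumL (map h allG)

-- weights: t_i v_x = q_i^{m_i(x)} v_x, q₁ = q, q₂ = q³
mW : I → G → ℤ
mW i₁ g1 = + 1
mW i₂ g1 = + 0
mW i₁ g2 = -[1+ 0 ]
mW i₂ g2 = + 1
mW i₁ g3 = + 2
mW i₂ g3 = -[1+ 0 ]
mW i₁ g0 = + 0
mW i₂ g0 = + 0
mW i₁ g3b = -[1+ 1 ]
mW i₂ g3b = + 1
mW i₁ g2b = + 1
mW i₂ g2b = -[1+ 0 ]
mW i₁ g1b = -[1+ 0 ]
mW i₂ g1b = + 0

qi : I → ℤ
qi i₁ = + 1
qi i₂ = + 3

tW : I → G → Lau
tW i x = qPow (qi i ℤ.* mW i x)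

_==G_ : G → G → Bool
a ==G b with rank a Data.Nat.≟ rank b
... | Relation.Nullary.yes _ = true
... | Relation.Nullary.no _ = false

-- matrix coefficient: f_i v_x = Σ_y fc i x y · v_y
fc : I → G → G → Lau
fc i₁ g0 y = if y ==G g3b then (qPow (+ 1) +L qPow -[1+ 0 ]) else 0L
fc i₂ g0 y = 0L
fc i x y with fL i x
... | just z = if y ==G z then 1L else 0L
... | nothing = 0L

-- V(Λ₁) and V(Λ₁)⊗V(Λ₁) as coordinate vectors
V1 V2 : Set
V1 = G → Lau
V2 = G → G → Lau

basis1 : G → V1
basis1 x y = if x ==G y then 1L else 0L

basis2 : G → G → V2
basis2 x y a b = if x ==G a then (if y ==G b then 1L else 0L) else 0L

F1 : I → V1 → V1
F1 i v y = sumG (λ x → v x *L fc i x y)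

-- f_i(u ⊗ v) = f_i u ⊗ v + t_i u ⊗ f_i v
F2 : I → V2 → V2
F2 i w a b =
  sumG (λ x → w x b *L fc i x a) +L (tW i a *L sumG (λ y → w a y *L fc i y b))

-- N ≅ V(2Λ₁) : the submodule generated by the highest weight vector
-- v₁ ⊗ v₁, i.e. the Q(q)-span of the vectors f_{j₁}⋯f_{j_m}(v₁⊗v₁).
applyFs : List I → V2 → V2
applyFs [] w = w
applyFs (i ∷ is) w = F2 i (applyFs is w)

-- membership in the Q(q)-span, denominators cleared: c·w ∈ ℤ[q,q⁻¹]-span
InN : V2 → Set
InN w = Σ Lau λ c → ¬ (c ≈L 0L) × Σ (List (Lau × List I)) λ comb →
  ∀ a b → (c *L w a b) ≈L
    sumL (map (λ p → Data.Product.proj₁ p *L applyFs (Data.Product.proj₂ p) (basis2 g1 g1) a b) comb)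

-- "f_i v_C ≠ 0": in V(Λ₁) for height 1, in W(Λ₂) = V(Λ₁)^{⊗2}/N for height 2
fNonzero : I → Col → Set
fNonzero i (col1 a) = ¬ (∀ y → F1 i (basis1 a) y ≈L 0L)
fNonzero i (col2 a b) = ¬ InN (F2 i (basis2 a b))

Is1or12 : Col → Set
Is1or12 C = (C ≡ col1 g1) ⊎ (C ≡ col2 g1 g2)

IsRightmostK : {s : ℕ} → Vec Col s → Fin s → Set
IsRightmostK T k = ¬ Is1or12 (lookup T k)
  × (∀ j → toℕ k < toℕ j → Is1or12 (lookup T j))

IsI1 : Col → I → Set
IsI1 C i = (C ≢ col2 g0 g2b → eW i C ≢ nothing)
         × (C ≡ col2 g0 g2b → i ≡ i₁)

LCond : {s : ℕ} → Vec Col s → Fin s → I → Fin s → Set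
LCond T k i l = toℕ l < toℕ k
  × (∀ j → toℕ l < toℕ j → toℕ j ≤ toℕ k → ¬ fNonzero i (lookup T j))
  × (∀ j → toℕ l ≤ toℕ j → toℕ j ≤ toℕ k → eW i (lookup T j) ≢ nothing)

IsL : {s : ℕ} → Vec Col s → Fin s → I → Fin s → Set
IsL T k i l =
    (toℕ k ≡ 0 × l ≡ k)
  ⊎ (Σ (Fin _) λ k' → suc (toℕ k') ≡ toℕ k ×
      (  ((fNonzero i (lookup T k) ⊎ eW i (lookup T k') ≡ nothing) × l ≡ k)
       ⊎ ( ¬ fNonzero i (lookup T k) × eW i (lookup T k') ≢ nothing
         × LCond T k i l × (∀ l' → LCond T k i l' → toℕ l ≤ toℕ l'))))

T1 : {s : ℕ} → Vec Col s → I → Fin s → Fin s → Vec Col s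
T1 T i l k = tabulate λ j →
  if (toℕ j Data.Nat.<ᵇ toℕ l) then lookup T j
  else (if (toℕ k Data.Nat.<ᵇ toℕ j) then lookup T j else raise i (lookup T j))

{-# OPTIONS --safe #-}
-- Outside the window C_l … C_k nothing changes, and inside it every column is replaced by its
-- i-raise ẽ_i^max.  A finite check over all 56 fillings shows that raising preserves height and
-- admissibility, and preserves ⊑ between two raised columns and between a raised column and an
-- unchanged one on its right.  On the remaining boundary, C_{l-1} ⊑ raise C_l can only fail when
-- ẽ_i(C_{l-1}) ≠ 0 and f_i v_{C_l} = 0; but then l - 1 would also satisfy the conditions defining
-- l, contradicting its minimality.  The vanishing of f_i v_C is computed in V(Λ₁), resp. in V(Λ₁)^{⊗2}, where for
-- the single column 0 3̄ the vector f₁(v₀ ⊗ v₃̄) is a nonzero multiple of f₁⁴f₂²f₁²(v₁ ⊗ v₁),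
-- which lies in N.
module Submission where

open import Defs
open import Data.Nat using (ℕ; _+_)
open import Data.Vec using (Vec; lookup)
open import Data.Fin using (Fin)
open import Relation.Binary.PropositionalEquality using (_≢_)

open import Data.Bool using (true; false; if_then_else_)
open import Data.Empty using (⊥-elim)
open import Data.Fin using (toℕ)
import Data.Fin.Properties as FinP
open import Data.Integer as ℤ using (ℤ; +_; -[1+_])
import Data.Integer.Properties as ℤP
open import Algebra.Properties.CommutativeSemigroup ℤP.+-commutativeSemigroup using (x∙yz≈y∙xz)
open import Data.Integer.Tactic.RingSolver using (solve-∀)
open import Data.List using (List; []; _∷_; _++_; replicate; map)
open import Data.List.Membership.Propositional using (_∈_)
open import Data.List.Relation.Unary.All as All using (All; []; _∷_)
open import Data.Maybe using (Maybe; just; nothing)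
open import Data.Nat using (zero; suc; _<_; _≤_; _<ᵇ_)
import Data.Nat.Properties as ℕP
open import Data.Product using (_×_; _,_; proj₁; proj₂; uncurry)
open import Data.Sum using (_⊎_; inj₁; inj₂)
import Data.Vec.Properties as VecP
open import Function using (_∘_)
open import Relation.Binary.Definitions using (DecidableEquality)
open import Relation.Binary.PropositionalEquality
  using (_≡_; refl; sym; trans; cong; cong₂; subst; subst₂; module ≡-Reasoning)
open import Relation.Nullary
  using (Dec; yes; no; ¬_; ¬?; _×-dec_; _⊎-dec_; _→-dec_; map′; ofʸ; ofⁿ)
open import Relation.Nullary.Decidable using (from-yes; True; toWitness)
open ≡-Reasoning

fromRank : ℕ → G
fromRank 0 = g1
fromRank 1 = g2
fromRank 2 = g3
fromRank 3 = g0
fromRank 4 = g3b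
fromRank 5 = g2b
fromRank _ = g1b

fromRank-rank : ∀ a → fromRank (rank a) ≡ a
fromRank-rank g1  = refl
fromRank-rank g2  = refl
fromRank-rank g3  = refl
fromRank-rank g0  = refl
fromRank-rank g3b = refl
fromRank-rank g2b = refl
fromRank-rank g1b = refl

rank-injective : ∀ {a b} → rank a ≡ rank b → a ≡ b
rank-injective {a} {b} e = trans (sym (fromRank-rank a)) (trans (cong fromRank e) (fromRank-rank b))

_≟G_ : DecidableEquality G
a ≟G b = map′ rank-injective (cong rank) (rank a ℕP.≟ rank b)

_≟C_ : DecidableEquality Col
col1 a   ≟C col1 c   = map′ (cong col1) (λ { refl → refl }) (a ≟G c)
col2 a b ≟C col2 c d =
  map′ (λ { (refl , refl) → refl }) (λ { refl → refl , refl }) ((a ≟G c) ×-dec (b ≟G d))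
col1 _   ≟C col2 _ _ = no λ ()
col2 _ _ ≟C col1 _   = no λ ()

open import Data.List.Membership.DecPropositional _≟C_ using (_∈?_)

∀G? : {P : G → Set} → (∀ a → Dec (P a)) → Dec (∀ a → P a)
∀G? {P} P? = map′ fromTuple (λ h → h g1 , h g2 , h g3 , h g0 , h g3b , h g2b , h g1b)
  (P? g1 ×-dec P? g2 ×-dec P? g3 ×-dec P? g0 ×-dec P? g3b ×-dec P? g2b ×-dec P? g1b)
  where
  fromTuple : P g1 × P g2 × P g3 × P g0 × P g3b × P g2b × P g1b → ∀ a → P a
  fromTuple (p , _)                     g1  = p
  fromTuple (_ , p , _)                 g2  = p
  fromTuple (_ , _ , p , _)             g3  = p
  fromTuple (_ , _ , _ , p , _)         g0  = p
  fromTuple (_ , _ , _ , _ , p , _)     g3b = p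
  fromTuple (_ , _ , _ , _ , _ , p , _) g2b = p
  fromTuple (_ , _ , _ , _ , _ , _ , p) g1b = p

∀I? : {P : I → Set} → (∀ i → Dec (P i)) → Dec (∀ i → P i)
∀I? {P} P? = map′ fromPair (λ h → h i₁ , h i₂) (P? i₁ ×-dec P? i₂)
  where
  fromPair : P i₁ × P i₂ → ∀ i → P i
  fromPair (p , _) i₁ = p
  fromPair (_ , p) i₂ = p

∀Col? : {P : Col → Set} → (∀ C → Dec (P C)) → Dec (∀ C → P C)
∀Col? {P} P? = map′ fromPair (λ h → h ∘ col1 , λ a b → h (col2 a b))
  (∀G? (P? ∘ col1) ×-dec ∀G? (λ a → ∀G? (λ b → P? (col2 a b))))
  where
  fromPair : (∀ a → P (col1 a)) × (∀ a b → P (col2 a b)) → ∀ C → P C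
  fromPair (h , _) (col1 a)   = h a
  fromPair (_ , h) (col2 a b) = h a b

_≗_ : Poly → Poly → Set
p ≗ q = ∀ m → coefP p m ≡ coefP q m

zeros : ℕ → Poly
zeros t = replicate t (+ 0)

coefP-addP : ∀ p q m → coefP (addP p q) m ≡ coefP p m ℤ.+ coefP q m
coefP-addP []      q       m       = sym (ℤP.+-identityˡ _)
coefP-addP (a ∷ p) []      m       = sym (ℤP.+-identityʳ _)
coefP-addP (a ∷ p) (b ∷ q) zero    = refl
coefP-addP (a ∷ p) (b ∷ q) (suc m) = coefP-addP p q m

coefP-map : ∀ a q m → coefP (map (a ℤ.*_) q) m ≡ a ℤ.* coefP q m
coefP-map a []      m       = sym (ℤP.*-zeroʳ a)
coefP-map a (b ∷ q) zero    = refl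
coefP-map a (b ∷ q) (suc m) = coefP-map a q m

mulP-[] : ∀ p → mulP p [] ≗ []
mulP-[] []      m       = refl
mulP-[] (a ∷ p) zero    = refl
mulP-[] (a ∷ p) (suc m) = mulP-[] p m

mulP-∷ : ∀ p b q → mulP p (b ∷ q) ≗ addP (map (b ℤ.*_) p) (+ 0 ∷ mulP p q)
mulP-∷ []      b q zero    = refl
mulP-∷ []      b q (suc m) = refl
mulP-∷ (a ∷ p) b q zero    = cong (ℤ._+ + 0) (ℤP.*-comm a b)
mulP-∷ (a ∷ p) b q (suc m) = begin
  coefP (addP (map (a ℤ.*_) q) (mulP p (b ∷ q))) m
    ≡⟨ coefP-addP (map (a ℤ.*_) q) _ m ⟩
  coefP (map (a ℤ.*_) q) m ℤ.+ coefP (mulP p (b ∷ q)) m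
    ≡⟨ cong₂ ℤ._+_ (coefP-map a q m) (trans (mulP-∷ p b q m) (coefP-addP (map (b ℤ.*_) p) _ m)) ⟩
  aq ℤ.+ (coefP (map (b ℤ.*_) p) m ℤ.+ r)
    ≡⟨ cong (λ u → aq ℤ.+ (u ℤ.+ r)) (coefP-map b p m) ⟩
  aq ℤ.+ (bp ℤ.+ r)
    ≡⟨ x∙yz≈y∙xz aq bp r ⟩
  bp ℤ.+ (aq ℤ.+ r)
    ≡⟨ cong₂ ℤ._+_ (sym (coefP-map b p m))
                   (sym (trans (coefP-addP (map (a ℤ.*_) q) _ m) (cong (ℤ._+ r) (coefP-map a q m)))) ⟩
  coefP (map (b ℤ.*_) p) m ℤ.+ coefP (mulP (a ∷ p) q) m
    ≡⟨ sym (coefP-addP (map (b ℤ.*_) p) _ m) ⟩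
  coefP (addP (map (b ℤ.*_) p) (mulP (a ∷ p) q)) m ∎
  where
  aq bp r : ℤ
  aq = a ℤ.* coefP q m
  bp = b ℤ.* coefP p m
  r  = coefP (+ 0 ∷ mulP p q) m

coefℤ : ℤ → Poly → ℤ
coefℤ (+ m)    p = coefP p m
coefℤ -[1+ _ ] _ = + 0

coeff≡coefℤ : ∀ x n → coeff x n ≡ coefℤ (n ℤ.+ + sh x) (cs x)
coeff≡coefℤ x n with n ℤ.+ + sh x
... | + m      = refl
... | -[1+ _ ] = refl

coefℤ-cong : ∀ {p q} → p ≗ q → ∀ z → coefℤ z p ≡ coefℤ z q
coefℤ-cong h (+ m)    = h m
coefℤ-cong h -[1+ _ ] = refl

coefℤ-[] : ∀ z → coefℤ z [] ≡ + 0
coefℤ-[] (+ m)    = refl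
coefℤ-[] -[1+ _ ] = refl

coefℤ-addP : ∀ z p q → coefℤ z (addP p q) ≡ coefℤ z p ℤ.+ coefℤ z q
coefℤ-addP (+ m)    p q = coefP-addP p q m
coefℤ-addP -[1+ _ ] p q = refl

coefℤ-map : ∀ z a p → coefℤ z (map (a ℤ.*_) p) ≡ a ℤ.* coefℤ z p
coefℤ-map (+ m)    a p = coefP-map a p m
coefℤ-map -[1+ _ ] a p = sym (ℤP.*-zeroʳ a)

coefℤ-0∷ : ∀ z p → coefℤ (z ℤ.+ + 1) (+ 0 ∷ p) ≡ coefℤ z p
coefℤ-0∷ (+ m)         p rewrite ℕP.+-comm m 1 = refl
coefℤ-0∷ -[1+ zero ]   p = refl
coefℤ-0∷ -[1+ suc _ ]  p = refl

coefℤ-zeros : ∀ t z p → coefℤ (z ℤ.+ + t) (zeros t ++ p) ≡ coefℤ z p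
coefℤ-zeros zero    z p = cong (λ w → coefℤ w p) (ℤP.+-identityʳ z)
coefℤ-zeros (suc t) z p = begin
  coefℤ (z ℤ.+ + suc t) (+ 0 ∷ zeros t ++ p)
    ≡⟨ cong (λ w → coefℤ w (+ 0 ∷ zeros t ++ p)) z+1+t ⟩
  coefℤ ((z ℤ.+ + t) ℤ.+ + 1) (+ 0 ∷ zeros t ++ p)
    ≡⟨ coefℤ-0∷ (z ℤ.+ + t) _ ⟩
  coefℤ (z ℤ.+ + t) (zeros t ++ p)
    ≡⟨ coefℤ-zeros t z p ⟩
  coefℤ z p ∎
  where
  z+1+t : z ℤ.+ + suc t ≡ (z ℤ.+ + t) ℤ.+ + 1
  z+1+t = trans (cong (λ u → z ℤ.+ + u) (ℕP.+-comm 1 t)) (sym (ℤP.+-assoc z (+ t) (+ 1)))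

coefℤ-padded : ∀ n s t p → coefℤ (n ℤ.+ + (s + t)) (zeros t ++ p) ≡ coefℤ (n ℤ.+ + s) p
coefℤ-padded n s t p =
  trans (cong (λ w → coefℤ w (zeros t ++ p)) (sym (ℤP.+-assoc n (+ s) (+ t))))
        (coefℤ-zeros t (n ℤ.+ + s) p)

coeff-+L : ∀ x y n → coeff (x +L y) n ≡ coeff x n ℤ.+ coeff y n
coeff-+L x y n = begin
  coeff (x +L y) n
    ≡⟨ coeff≡coefℤ (x +L y) n ⟩
  coefℤ N (addP (zeros (sh y) ++ cs x) (zeros (sh x) ++ cs y))
    ≡⟨ coefℤ-addP N (zeros (sh y) ++ cs x) (zeros (sh x) ++ cs y) ⟩
  coefℤ N (zeros (sh y) ++ cs x) ℤ.+ coefℤ N (zeros (sh x) ++ cs y)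
    ≡⟨ cong₂ ℤ._+_ (coefℤ-padded n (sh x) (sh y) (cs x))
                   (trans (cong (λ u → coefℤ (n ℤ.+ + u) (zeros (sh x) ++ cs y)) (ℕP.+-comm (sh x) (sh y)))
                          (coefℤ-padded n (sh y) (sh x) (cs y))) ⟩
  coefℤ (n ℤ.+ + sh x) (cs x) ℤ.+ coefℤ (n ℤ.+ + sh y) (cs y)
    ≡⟨ sym (cong₂ ℤ._+_ (coeff≡coefℤ x n) (coeff≡coefℤ y n)) ⟩
  coeff x n ℤ.+ coeff y n ∎
  where
  N : ℤ
  N = n ℤ.+ + (sh x + sh y)

coefℤ-step : ∀ z a p r →
             coefℤ z (addP (map (a ℤ.*_) p) (+ 0 ∷ r)) ≡ a ℤ.* coefℤ z p ℤ.+ coefℤ (z ℤ.- + 1) r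
coefℤ-step z a p r = begin
  coefℤ z (addP (map (a ℤ.*_) p) (+ 0 ∷ r))       ≡⟨ coefℤ-addP z (map (a ℤ.*_) p) _ ⟩
  coefℤ z (map (a ℤ.*_) p) ℤ.+ coefℤ z (+ 0 ∷ r)  ≡⟨ cong₂ ℤ._+_ (coefℤ-map z a p) lowered ⟩
  a ℤ.* coefℤ z p ℤ.+ coefℤ (z ℤ.- + 1) r         ∎
  where
  z-1+1 : ∀ z → z ≡ (z ℤ.- + 1) ℤ.+ + 1
  z-1+1 = solve-∀

  lowered : coefℤ z (+ 0 ∷ r) ≡ coefℤ (z ℤ.- + 1) r
  lowered = trans (cong (λ w → coefℤ w (+ 0 ∷ r)) (z-1+1 z)) (coefℤ-0∷ (z ℤ.- + 1) r)

coefℤ-shifted : ∀ x n s → coefℤ (n ℤ.+ + (s + sh x)) (cs x) ≡ coeff x (n ℤ.+ + s)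
coefℤ-shifted x n s =
  trans (cong (λ w → coefℤ w (cs x)) (sym (ℤP.+-assoc n (+ s) (+ sh x))))
        (sym (coeff≡coefℤ x (n ℤ.+ + s)))

coefℤ-lowered : ∀ x n → coefℤ (n ℤ.+ + sh x ℤ.- + 1) (cs x) ≡ coeff x (n ℤ.- + 1)
coefℤ-lowered x n =
  trans (cong (λ w → coefℤ w (cs x)) (n+t-1 n (+ sh x))) (sym (coeff≡coefℤ x (n ℤ.- + 1)))
  where
  n+t-1 : ∀ n t → n ℤ.+ t ℤ.- + 1 ≡ (n ℤ.- + 1) ℤ.+ t
  n+t-1 = solve-∀

-- lau s (a ∷ p) is q^{-s} (a + q · p)
coeff-∷*L : ∀ s a p y n →
            coeff (lau s (a ∷ p) *L y) n ≡ a ℤ.* coeff y (n ℤ.+ + s) ℤ.+ coeff (lau s p *L y) (n ℤ.- + 1)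
coeff-∷*L s a p y n = begin
  coeff (lau s (a ∷ p) *L y) n
    ≡⟨ coeff≡coefℤ (lau s (a ∷ p) *L y) n ⟩
  coefℤ N (addP (map (a ℤ.*_) (cs y)) (+ 0 ∷ mulP p (cs y)))
    ≡⟨ coefℤ-step N a (cs y) (mulP p (cs y)) ⟩
  a ℤ.* coefℤ N (cs y) ℤ.+ coefℤ (N ℤ.- + 1) (mulP p (cs y))
    ≡⟨ cong₂ ℤ._+_ (cong (a ℤ.*_) (coefℤ-shifted y n s)) (coefℤ-lowered (lau s p *L y) n) ⟩
  a ℤ.* coeff y (n ℤ.+ + s) ℤ.+ coeff (lau s p *L y) (n ℤ.- + 1) ∎
  where
  N : ℤ
  N = n ℤ.+ + (s + sh y)

coeff-*L∷ : ∀ x s b q n →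
            coeff (x *L lau s (b ∷ q)) n ≡ b ℤ.* coeff x (n ℤ.+ + s) ℤ.+ coeff (x *L lau s q) (n ℤ.- + 1)
coeff-*L∷ x s b q n = begin
  coeff (x *L lau s (b ∷ q)) n
    ≡⟨ coeff≡coefℤ (x *L lau s (b ∷ q)) n ⟩
  coefℤ N (mulP (cs x) (b ∷ q))
    ≡⟨ coefℤ-cong (mulP-∷ (cs x) b q) N ⟩
  coefℤ N (addP (map (b ℤ.*_) (cs x)) (+ 0 ∷ mulP (cs x) q))
    ≡⟨ coefℤ-step N b (cs x) (mulP (cs x) q) ⟩
  b ℤ.* coefℤ N (cs x) ℤ.+ coefℤ (N ℤ.- + 1) (mulP (cs x) q)
    ≡⟨ cong (λ u → b ℤ.* coefℤ (n ℤ.+ + u) (cs x) ℤ.+ coefℤ (N ℤ.- + 1) (mulP (cs x) q))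
            (ℕP.+-comm (sh x) s) ⟩
  b ℤ.* coefℤ (n ℤ.+ + (s + sh x)) (cs x) ℤ.+ coefℤ (N ℤ.- + 1) (mulP (cs x) q)
    ≡⟨ cong₂ ℤ._+_ (cong (b ℤ.*_) (coefℤ-shifted x n s)) (coefℤ-lowered (x *L lau s q) n) ⟩
  b ℤ.* coeff x (n ℤ.+ + s) ℤ.+ coeff (x *L lau s q) (n ℤ.- + 1) ∎
  where
  N : ℤ
  N = n ℤ.+ + (sh x + s)

coeff-[]*L : ∀ s y n → coeff (lau s [] *L y) n ≡ + 0
coeff-[]*L s y n = trans (coeff≡coefℤ (lau s [] *L y) n) (coefℤ-[] (n ℤ.+ + (s + sh y)))

coeff-*L[] : ∀ x s n → coeff (x *L lau s []) n ≡ + 0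
coeff-*L[] x s n = trans (coeff≡coefℤ (x *L lau s []) n) (trans (coefℤ-cong (mulP-[] (cs x)) N) (coefℤ-[] N))
  where
  N : ℤ
  N = n ℤ.+ + (sh x + s)

≈L-refl : ∀ {x} → x ≈L x
≈L-refl n = refl

≈L-trans : ∀ {x y z} → x ≈L y → y ≈L z → x ≈L z
≈L-trans h g n = trans (h n) (g n)

+L-cong : ∀ {x x' y y'} → x ≈L x' → y ≈L y' → (x +L y) ≈L (x' +L y')
+L-cong {x} {x'} {y} {y'} h g n = begin
  coeff (x +L y) n            ≡⟨ coeff-+L x y n ⟩
  coeff x n ℤ.+ coeff y n     ≡⟨ cong₂ ℤ._+_ (h n) (g n) ⟩
  coeff x' n ℤ.+ coeff y' n   ≡⟨ sym (coeff-+L x' y' n) ⟩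
  coeff (x' +L y') n          ∎

*L-congʳ : ∀ x {y y'} → y ≈L y' → (x *L y) ≈L (x *L y')
*L-congʳ (lau s [])      {y} {y'} h n = trans (coeff-[]*L s y n) (sym (coeff-[]*L s y' n))
*L-congʳ (lau s (a ∷ p)) {y} {y'} h n = begin
  coeff (lau s (a ∷ p) *L y) n
    ≡⟨ coeff-∷*L s a p y n ⟩
  a ℤ.* coeff y (n ℤ.+ + s) ℤ.+ coeff (lau s p *L y) (n ℤ.- + 1)
    ≡⟨ cong₂ ℤ._+_ (cong (a ℤ.*_) (h (n ℤ.+ + s))) (*L-congʳ (lau s p) h (n ℤ.- + 1)) ⟩
  a ℤ.* coeff y' (n ℤ.+ + s) ℤ.+ coeff (lau s p *L y') (n ℤ.- + 1)
    ≡⟨ sym (coeff-∷*L s a p y' n) ⟩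
  coeff (lau s (a ∷ p) *L y') n ∎

*L-congˡ : ∀ {x x'} y → x ≈L x' → (x *L y) ≈L (x' *L y)
*L-congˡ {x} {x'} (lau s [])      h n = trans (coeff-*L[] x s n) (sym (coeff-*L[] x' s n))
*L-congˡ {x} {x'} (lau s (b ∷ q)) h n = begin
  coeff (x *L lau s (b ∷ q)) n
    ≡⟨ coeff-*L∷ x s b q n ⟩
  b ℤ.* coeff x (n ℤ.+ + s) ℤ.+ coeff (x *L lau s q) (n ℤ.- + 1)
    ≡⟨ cong₂ ℤ._+_ (cong (b ℤ.*_) (h (n ℤ.+ + s))) (*L-congˡ (lau s q) h (n ℤ.- + 1)) ⟩
  b ℤ.* coeff x' (n ℤ.+ + s) ℤ.+ coeff (x' *L lau s q) (n ℤ.- + 1)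
    ≡⟨ sym (coeff-*L∷ x' s b q n) ⟩
  coeff (x' *L lau s (b ∷ q)) n ∎

tl : Poly → Poly
tl []      = []
tl (_ ∷ p) = p

coefP-suc : ∀ p m → coefP p (suc m) ≡ coefP (tl p) m
coefP-suc []      m = refl
coefP-suc (a ∷ p) m = refl

≗-by-tl : ∀ {p q} → Dec (tl p ≗ tl q) → Dec (p ≗ q)
≗-by-tl {p} {q} tl? = map′ (uncurry join) split ((coefP p 0 ℤ.≟ coefP q 0) ×-dec tl?)
  where
  join : coefP p 0 ≡ coefP q 0 → tl p ≗ tl q → p ≗ q
  join h₀ h zero    = h₀
  join h₀ h (suc m) = trans (coefP-suc p m) (trans (h m) (sym (coefP-suc q m)))

  split : p ≗ q → coefP p 0 ≡ coefP q 0 × tl p ≗ tl q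
  split h = h 0 , λ m → trans (sym (coefP-suc p m)) (trans (h (suc m)) (coefP-suc q m))

_≗?_ : ∀ p q → Dec (p ≗ q)
[]      ≗? []      = yes λ _ → refl
[]      ≗? (b ∷ q) = ≗-by-tl {[]} {b ∷ q} ([] ≗? q)
(a ∷ p) ≗? []      = ≗-by-tl {a ∷ p} {[]} (p ≗? [])
(a ∷ p) ≗? (b ∷ q) = ≗-by-tl {a ∷ p} {b ∷ q} (p ≗? q)

-- x and y written over the common denominator q^{sh x + sh y}
_≗L_ : Lau → Lau → Set
x ≗L y = (zeros (sh y) ++ cs x) ≗ (zeros (sh x) ++ cs y)

_≗L?_ : ∀ x y → Dec (x ≗L y)
x ≗L? y = (zeros (sh y) ++ cs x) ≗? (zeros (sh x) ++ cs y)

≗L⇒≈L : ∀ {x y} → x ≗L y → x ≈L y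
≗L⇒≈L {x} {y} h n = begin
  coeff x n                                ≡⟨ coeff≡coefℤ x n ⟩
  coefℤ (n ℤ.+ + sh x) (cs x)              ≡⟨ sym (coefℤ-padded n (sh x) (sh y) (cs x)) ⟩
  coefℤ N (zeros (sh y) ++ cs x)           ≡⟨ coefℤ-cong h N ⟩
  coefℤ N (zeros (sh x) ++ cs y)           ≡⟨ cong (λ u → coefℤ (n ℤ.+ + u) (zeros (sh x) ++ cs y))
                                                   (ℕP.+-comm (sh x) (sh y)) ⟩
  coefℤ (n ℤ.+ + (sh y + sh x)) (zeros (sh x) ++ cs y)
                                           ≡⟨ coefℤ-padded n (sh y) (sh x) (cs y) ⟩
  coefℤ (n ℤ.+ + sh y) (cs y)              ≡⟨ sym (coeff≡coefℤ y n) ⟩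
  coeff y n                                ∎
  where
  N : ℤ
  N = n ℤ.+ + (sh x + sh y)

_≈V_ : V2 → V2 → Set
w ≈V w' = ∀ a b → w a b ≈L w' a b

≈V1-by-evaluation : (v v' : V1) → {True (∀G? λ a → v a ≗L? v' a)} → ∀ a → v a ≈L v' a
≈V1-by-evaluation v v' {ok} a = ≗L⇒≈L (toWitness ok a)

≈V-by-evaluation : (w w' : V2) → {True (∀G? λ a → ∀G? λ b → w a b ≗L? w' a b)} → w ≈V w'
≈V-by-evaluation w w' {ok} a b = ≗L⇒≈L (toWitness ok a b)

sumL-map-cong : {A : Set} (xs : List A) {h h' : A → Lau} →
                (∀ x → h x ≈L h' x) → sumL (map h xs) ≈L sumL (map h' xs)
sumL-map-cong []       e = ≈L-refl {0L}
sumL-map-cong (x ∷ xs) e = +L-cong (e x) (sumL-map-cong xs e)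

F2-cong : ∀ i {w w'} → w ≈V w' → F2 i w ≈V F2 i w'
F2-cong i h a b =
  +L-cong (sumL-map-cong allG λ x → *L-congˡ (fc i x a) (h x b))
          (*L-congʳ (tW i a) (sumL-map-cong allG λ y → *L-congˡ (fc i y b) (h a y)))

trim : Lau → Lau
trim (lau (suc s) (+ 0 ∷ p)) = trim (lau s p)
trim x                       = x

trim-≈ : ∀ x → trim x ≈L x
trim-≈ (lau (suc s) (+ 0 ∷ p)) n = begin
  coeff (trim (lau s p)) n          ≡⟨ trim-≈ (lau s p) n ⟩
  coeff (lau s p) n                 ≡⟨ coeff≡coefℤ (lau s p) n ⟩
  coefℤ (n ℤ.+ + s) p               ≡⟨ sym (coefℤ-padded n s 1 p) ⟩
  coefℤ (n ℤ.+ + (s + 1)) (+ 0 ∷ p) ≡⟨ cong (λ u → coefℤ (n ℤ.+ + u) (+ 0 ∷ p))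
                                            (ℕP.+-comm s 1) ⟩
  coefℤ (n ℤ.+ + suc s) (+ 0 ∷ p)   ≡⟨ sym (coeff≡coefℤ (lau (suc s) (+ 0 ∷ p)) n) ⟩
  coeff (lau (suc s) (+ 0 ∷ p)) n   ∎
trim-≈ (lau zero p)                 = ≈L-refl
trim-≈ (lau (suc s) [])             = ≈L-refl
trim-≈ (lau (suc s) (+ suc m ∷ p))  = ≈L-refl
trim-≈ (lau (suc s) (-[1+ m ] ∷ p)) = ≈L-refl

-- The entries f a are passed as arguments, so that evaluation shares them between lookups.
memoG : {A : Set} → (G → A) → G → A
memoG {A} f = table (f g1) (f g2) (f g3) (f g0) (f g3b) (f g2b) (f g1b)
  where
  table : A → A → A → A → A → A → A → G → A
  table x _ _ _ _ _ _ g1  = x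
  table _ x _ _ _ _ _ g2  = x
  table _ _ x _ _ _ _ g3  = x
  table _ _ _ x _ _ _ g0  = x
  table _ _ _ _ x _ _ g3b = x
  table _ _ _ _ _ x _ g2b = x
  table _ _ _ _ _ _ x g1b = x

memoG-≡ : {A : Set} (f : G → A) → ∀ a → memoG f a ≡ f a
memoG-≡ f g1  = refl
memoG-≡ f g2  = refl
memoG-≡ f g3  = refl
memoG-≡ f g0  = refl
memoG-≡ f g3b = refl
memoG-≡ f g2b = refl
memoG-≡ f g1b = refl

-- Evaluating applyFs itself is hopeless: every +L adds up the shifts of its summands.
F2-trimmed : I → V2 → V2
F2-trimmed i w = memoG λ a → memoG λ b → trim (F2 i w a b)

F2-trimmed-≈ : ∀ i w → F2-trimmed i w ≈V F2 i w
F2-trimmed-≈ i w a b n = begin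
  coeff (F2-trimmed i w a b) n   ≡⟨ cong (λ x → coeff x n) memo-entry ⟩
  coeff (trim (F2 i w a b)) n    ≡⟨ trim-≈ (F2 i w a b) n ⟩
  coeff (F2 i w a b) n           ∎
  where
  memo-entry : F2-trimmed i w a b ≡ trim (F2 i w a b)
  memo-entry = trans (cong (λ row → row b) (memoG-≡ (λ a → memoG λ b → trim (F2 i w a b)) a))
                     (memoG-≡ (λ b → trim (F2 i w a b)) b)

applyFs-trimmed : List I → V2 → V2
applyFs-trimmed []       w = w
applyFs-trimmed (i ∷ is) w = F2-trimmed i (applyFs-trimmed is w)

applyFs-trimmed-≈ : ∀ is w → applyFs-trimmed is w ≈V applyFs is w
applyFs-trimmed-≈ []       w a b = ≈L-refl
applyFs-trimmed-≈ (i ∷ is) w a b =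
  ≈L-trans (F2-trimmed-≈ i (applyFs-trimmed is w) a b) (F2-cong i (applyFs-trimmed-≈ is w) a b)

-- [2]_q [3]_q [4]_q [2]_{q³}, the ratio of f₁⁴f₂²f₁²(v₁ ⊗ v₁) to f₁(v₀ ⊗ v₃̄)
f₁[v₀⊗v₃̄]-scale : Lau
f₁[v₀⊗v₃̄]-scale = lau 9 (+ 1 ∷ + 0 ∷ + 3 ∷ + 0 ∷ + 5 ∷ + 0 ∷ + 7 ∷ + 0 ∷ + 8 ∷ + 0 ∷
                          + 8 ∷ + 0 ∷ + 7 ∷ + 0 ∷ + 5 ∷ + 0 ∷ + 3 ∷ + 0 ∷ + 1 ∷ [])

f₁⁴f₂²f₁² : List I
f₁⁴f₂²f₁² = i₁ ∷ i₁ ∷ i₁ ∷ i₁ ∷ i₂ ∷ i₂ ∷ i₁ ∷ i₁ ∷ []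

f₁[v₀⊗v₃̄]∈N : InN (F2 i₁ (basis2 g0 g3b))
f₁[v₀⊗v₃̄]∈N = f₁[v₀⊗v₃̄]-scale , scale≉0 , (1L , f₁⁴f₂²f₁²) ∷ [] , λ a b →
  ≈L-trans (≈V-by-evaluation (λ a b → f₁[v₀⊗v₃̄]-scale *L F2 i₁ (basis2 g0 g3b) a b)
                             (λ a b → (1L *L chain a b) +L 0L) a b)
           (+L-cong (*L-congʳ 1L (applyFs-trimmed-≈ f₁⁴f₂²f₁² (basis2 g1 g1) a b)) (≈L-refl {0L}))
  where
  chain : V2
  chain = applyFs-trimmed f₁⁴f₂²f₁² (basis2 g1 g1)

  scale≉0 : ¬ (f₁[v₀⊗v₃̄]-scale ≈L 0L)
  scale≉0 h with h (+ 1)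
  ... | ()

InN-by-vanishing : ∀ {w} → (λ a b → 1L *L w a b) ≈V (λ _ _ → 0L) → InN w
InN-by-vanishing h = 1L , 1L≉0 , [] , h
  where
  1L≉0 : ¬ (1L ≈L 0L)
  1L≉0 h with h (+ 0)
  ... | ()

f-col1-vanishes : ∀ i a → {True (∀G? λ y → F1 i (basis1 a) y ≗L? 0L)} → ¬ fNonzero i (col1 a)
f-col1-vanishes i a {ok} nonzero = nonzero (≈V1-by-evaluation (F1 i (basis1 a)) (λ _ → 0L) {ok})

f-col2-vanishes : ∀ i a b → {True (∀G? λ x → ∀G? λ y → (1L *L F2 i (basis2 a b) x y) ≗L? 0L)} →
                  ¬ fNonzero i (col2 a b)
f-col2-vanishes i a b {ok} nonzero = nonzero (InN-by-vanishing (≈V-by-evaluation _ _ {ok}))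

-- Only the columns killed by f_i that ⊑-raise-or-annihilated below needs.
annihilated : I → List Col
annihilated i₁ = col1 g2 ∷ col1 g3b ∷ col1 g1b ∷ col2 g2 g3b ∷ col2 g0 g3b ∷ col2 g3b g1b ∷ []
annihilated i₂ = col1 g3 ∷ col1 g2b ∷ col2 g1 g3 ∷ col2 g3 g2b ∷ col2 g0 g2b ∷ col2 g2b g1b ∷ []

annihilated-¬fNonzero : ∀ i → All (¬_ ∘ fNonzero i) (annihilated i)
annihilated-¬fNonzero i₁ =
  f-col1-vanishes i₁ g2 ∷ f-col1-vanishes i₁ g3b ∷ f-col1-vanishes i₁ g1b ∷
  f-col2-vanishes i₁ g2 g3b ∷ (λ nonzero → nonzero f₁[v₀⊗v₃̄]∈N) ∷
  f-col2-vanishes i₁ g3b g1b ∷ []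
annihilated-¬fNonzero i₂ =
  f-col1-vanishes i₂ g3 ∷ f-col1-vanishes i₂ g2b ∷
  f-col2-vanishes i₂ g1 g3 ∷ f-col2-vanishes i₂ g3 g2b ∷
  f-col2-vanishes i₂ g0 g2b ∷ f-col2-vanishes i₂ g2b g1b ∷ []

IsColumn? : ∀ C → Dec (IsColumn C)
IsColumn? (col1 a)   = yes _
IsColumn? (col2 a b) = (rank a ℕP.<? rank b) ⊎-dec ((a ≟G g0) ×-dec (b ≟G g0))

Admissible? : ∀ C → Dec (Admissible C)
Admissible? (col1 a)   = yes _
Admissible? (col2 a b) = dist a b ℕP.≤? admBound a

AdmissibleColumn : Col → Set
AdmissibleColumn C = IsColumn C × Admissible C

AdmissibleColumn? : ∀ C → Dec (AdmissibleColumn C)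
AdmissibleColumn? C = IsColumn? C ×-dec Admissible? C

NotBoth0? : ∀ a b → Dec (NotBoth0 a b)
NotBoth0? a b = ¬? ((a ≟G g0) ×-dec (b ≟G g0))

_⊑?_ : ∀ A B → Dec (A ⊑ B)
col1 a   ⊑? col1 b   = (rank a ℕP.≤? rank b) ×-dec NotBoth0? a b
col2 a b ⊑? col1 c   = (rank a ℕP.≤? rank c) ×-dec NotBoth0? a c
col2 a b ⊑? col2 c d = (rank a ℕP.≤? rank c) ×-dec NotBoth0? a c ×-dec
                       (rank b ℕP.≤? rank d) ×-dec NotBoth0? b d ×-dec
                       (distReq a ℕP.≤? dist a d)
col1 a   ⊑? col2 c d = no λ ()

≡nothing? : (m : Maybe Col) → Dec (m ≡ nothing)
≡nothing? nothing  = yes refl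
≡nothing? (just _) = no λ ()

raise-height : ∀ i C → height (raise i C) ≡ height C
raise-height = from-yes (∀I? λ i → ∀Col? λ C → height (raise i C) ℕP.≟ height C)

raise-admissible : ∀ i C → AdmissibleColumn C → AdmissibleColumn (raise i C)
raise-admissible = from-yes (∀I? λ i → ∀Col? λ C →
  AdmissibleColumn? C →-dec AdmissibleColumn? (raise i C))

raise-mono : ∀ i A B → AdmissibleColumn A → AdmissibleColumn B → A ⊑ B → raise i A ⊑ raise i B
raise-mono = from-yes (∀I? λ i → ∀Col? λ A → ∀Col? λ B →
  AdmissibleColumn? A →-dec AdmissibleColumn? B →-dec A ⊑? B →-dec raise i A ⊑? raise i B)

raise-⊑ : ∀ i A B → AdmissibleColumn A → AdmissibleColumn B → A ⊑ B → raise i A ⊑ B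
raise-⊑ = from-yes (∀I? λ i → ∀Col? λ A → ∀Col? λ B →
  AdmissibleColumn? A →-dec AdmissibleColumn? B →-dec A ⊑? B →-dec raise i A ⊑? B)

⊑-raise-or-annihilated : ∀ i A B → AdmissibleColumn A → AdmissibleColumn B → A ⊑ B →
                         A ⊑ raise i B ⊎ (eW i A ≢ nothing × B ∈ annihilated i)
⊑-raise-or-annihilated = from-yes (∀I? λ i → ∀Col? λ A → ∀Col? λ B →
  AdmissibleColumn? A →-dec AdmissibleColumn? B →-dec A ⊑? B →-dec
  ((A ⊑? raise i B) ⊎-dec (¬? (≡nothing? (eW i A)) ×-dec (B ∈? annihilated i))))

T1-lookup : ∀ {s} (T : Vec Col s) i (l k j : Fin s) →
            lookup (T1 T i l k) j ≡ (if toℕ j <ᵇ toℕ l then lookup T j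
                                     else (if toℕ k <ᵇ toℕ j then lookup T j else raise i (lookup T j)))
T1-lookup T i l k = VecP.lookup∘tabulate _

data T1-View {s : ℕ} (T : Vec Col s) (i : I) (l k j : Fin s) : Set where
  outside : toℕ j < toℕ l ⊎ toℕ k < toℕ j →
            lookup (T1 T i l k) j ≡ lookup T j → T1-View T i l k j
  inside  : toℕ l ≤ toℕ j → toℕ j ≤ toℕ k →
            lookup (T1 T i l k) j ≡ raise i (lookup T j) → T1-View T i l k j

T1-view : ∀ {s} (T : Vec Col s) i (l k j : Fin s) → T1-View T i l k j
T1-view T i l k j
  with toℕ j <ᵇ toℕ l | ℕP.<ᵇ-reflects-< (toℕ j) (toℕ l) | T1-lookup T i l k j
... | true  | ofʸ j<l | e = outside (inj₁ j<l) e
... | false | ofⁿ j≮l | e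
  with toℕ k <ᵇ toℕ j | ℕP.<ᵇ-reflects-< (toℕ k) (toℕ j) | e
...   | true  | ofʸ k<j | e′ = outside (inj₂ k<j) e′
...   | false | ofⁿ k≮j | e′ = inside (ℕP.≮⇒≥ j≮l) (ℕP.≮⇒≥ k≮j) e′

T1-preserves : ∀ {s} (P : Col → Set) (T : Vec Col s) {i} → (∀ C → P C → P (raise i C)) →
               ∀ l k j → P (lookup T j) → P (lookup (T1 T i l k) j)
T1-preserves P T {i} raise-P l k j p with T1-view T i l k j
... | outside _ e  = subst P (sym e) p
... | inside _ _ e = subst P (sym e) (raise-P _ p)

lookup-toℕ : ∀ {s} (T : Vec Col s) {j j′} → toℕ j ≡ toℕ j′ → lookup T j ≡ lookup T j′
lookup-toℕ T e = cong (lookup T) (FinP.toℕ-injective e)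

LCond-extend : ∀ {s} (T : Vec Col s) {k i l j} → suc (toℕ j) ≡ toℕ l →
               eW i (lookup T j) ≢ nothing → ¬ fNonzero i (lookup T l) →
               LCond T k i l → LCond T k i j
LCond-extend T {k} {i} {l} {j} jl raisable killed (l<k , noF , raisable′) =
  ℕP.<-trans j<l l<k , noF′ , raisable″
  where
  j<l : toℕ j < toℕ l
  j<l = ℕP.≤-reflexive jl

  noF′ : ∀ j″ → toℕ j < toℕ j″ → toℕ j″ ≤ toℕ k → ¬ fNonzero i (lookup T j″)
  noF′ j″ j<j″ j″≤k with ℕP.m≤n⇒m<n∨m≡n (subst (_≤ toℕ j″) jl j<j″)
  ... | inj₁ l<j″ = noF j″ l<j″ j″≤k
  ... | inj₂ l≡j″ = subst (¬_ ∘ fNonzero i) (lookup-toℕ T l≡j″) killed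

  raisable″ : ∀ j″ → toℕ j ≤ toℕ j″ → toℕ j″ ≤ toℕ k → eW i (lookup T j″) ≢ nothing
  raisable″ j″ j≤j″ j″≤k with ℕP.m≤n⇒m<n∨m≡n j≤j″
  ... | inj₁ j<j″ = raisable′ j″ (subst (_≤ toℕ j″) jl j<j″) j″≤k
  ... | inj₂ j≡j″ = subst (λ C → eW i C ≢ nothing) (lookup-toℕ T j≡j″) raisable

IsL-left-blocked : ∀ {s} (T : Vec Col s) {k i l} → IsL T k i l → ∀ j → suc (toℕ j) ≡ toℕ l →
                   eW i (lookup T j) ≢ nothing → ¬ ¬ fNonzero i (lookup T l)
IsL-left-blocked T (inj₁ (k≡0 , refl)) j jl raisable killed =
  ℕP.1+n≢0 (trans jl k≡0)
IsL-left-blocked T (inj₂ (k′ , k′k , inj₁ (inj₁ nonzero , refl))) j jl raisable killed =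
  killed nonzero
IsL-left-blocked T {i = i} (inj₂ (k′ , k′k , inj₁ (inj₂ k′-stuck , refl))) j jl raisable killed =
  raisable (trans (cong (eW i) (lookup-toℕ T (ℕP.suc-injective (trans jl (sym k′k))))) k′-stuck)
IsL-left-blocked T (inj₂ (k′ , k′k , inj₂ (_ , _ , cond , minimal))) j jl raisable killed =
  ℕP.<⇒≱ (ℕP.≤-reflexive jl) (minimal j (LCond-extend T jl raisable killed cond))

Ordered : ∀ {s} → Vec Col s → Set
Ordered {s} T = ∀ (j j′ : Fin s) → suc (toℕ j) ≡ toℕ j′ → lookup T j ⊑ lookup T j′

T1-ordered : ∀ {s} (T : Vec Col s) {k i l} → IsL T k i l →
             (∀ j → AdmissibleColumn (lookup T j)) → Ordered T → Ordered (T1 T i l k)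
T1-ordered T {k} {i} {l} isL valid ordered j j′ jj′ =
  adjacent (T1-view T i l k j) (T1-view T i l k j′)
  where
  A B : Col
  A = lookup T j
  B = lookup T j′

  adjacent : T1-View T i l k j → T1-View T i l k j′ →
             lookup (T1 T i l k) j ⊑ lookup (T1 T i l k) j′
  adjacent (outside _ e) (outside _ e′) =
    subst₂ _⊑_ (sym e) (sym e′) (ordered j j′ jj′)
  adjacent (inside _ _ e) (inside _ _ e′) =
    subst₂ _⊑_ (sym e) (sym e′) (raise-mono i A B (valid j) (valid j′) (ordered j j′ jj′))
  adjacent (inside _ _ e) (outside _ e′) =
    subst₂ _⊑_ (sym e) (sym e′) (raise-⊑ i A B (valid j) (valid j′) (ordered j j′ jj′))
  adjacent (outside (inj₂ k<j) _) (inside _ j′≤k _) =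
    ⊥-elim (ℕP.<⇒≱ k<j (ℕP.≤-trans (ℕP.n≤1+n (toℕ j)) (subst (_≤ toℕ k) (sym jj′) j′≤k)))
  adjacent (outside (inj₁ j<l) e) (inside l≤j′ _ e′) =
    subst₂ _⊑_ (sym e) (sym e′)
      (boundary (⊑-raise-or-annihilated i A B (valid j) (valid j′) (ordered j j′ jj′)))
    where
    j′≡l : toℕ j′ ≡ toℕ l
    j′≡l = ℕP.≤-antisym (subst (_≤ toℕ l) jj′ j<l) l≤j′

    boundary : A ⊑ raise i B ⊎ (eW i A ≢ nothing × B ∈ annihilated i) → A ⊑ raise i B
    boundary (inj₁ ok)                  = ok
    boundary (inj₂ (raisable , killed)) =
      ⊥-elim (IsL-left-blocked T isL j (trans jj′ j′≡l) raisable
               (subst (¬_ ∘ fNonzero i) (lookup-toℕ T j′≡l) (All.lookup (annihilated-¬fNonzero i) killed)))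

lemma4p3p2 : (λ₁ λ₂ : ℕ) (T : Vec Col (λ₂ + λ₁)) →
    IsTableau λ₁ λ₂ T → T ≢ Tλ λ₁ λ₂ →
    (k : Fin (λ₂ + λ₁)) → IsRightmostK T k →
    (i : I) → IsI1 (lookup T k) i →
    (l : Fin (λ₂ + λ₁)) → IsL T k i l →
    IsTableau λ₁ λ₂ (T1 T i l k)
lemma4p3p2 λ₁ λ₂ T (shape , columns , admissible , ordered) _ k _ i _ l isL =
  shape′ , proj₁ ∘ valid′ , proj₂ ∘ valid′ , T1-ordered T isL valid ordered
  where
  valid : ∀ j → AdmissibleColumn (lookup T j)
  valid j = columns j , admissible j

  valid′ : ∀ j → AdmissibleColumn (lookup (T1 T i l k) j)
  valid′ j = T1-preserves AdmissibleColumn T (raise-admissible i) l k j (valid j)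

  shape′ : ∀ j → height (lookup (T1 T i l k) j) ≡ (if toℕ j <ᵇ λ₂ then 2 else 1)
  shape′ j = T1-preserves (λ C → height C ≡ (if toℕ j <ᵇ λ₂ then 2 else 1)) T
                          (λ C e → trans (raise-height i C) e) l k j (shape j)
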